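{- Let $\mathit{accel}$ be the partial function defined on exactly those pairs $(\langle\chi,\vec a\rangle,\check\phi)$ (a loop and a quantifier-free formula over $\vec x$) for which \[ \check\phi(\vec x)\land\chi(\vec x)\implies\chi(\vec a(\vec x)) \] is valid, by \[ \mathit{accel}(\langle\chi,\vec a\rangle,\check\phi):=\bigl(\vec x'=\vec a^n(\vec x)\land\chi(\vec x)\bigr). \] Then $\mathit{accel}$ is an exact conditional acceleration technique.
   Context: Fix $d\ge 1$, integer variables $\vec x=(x_1,\dots,x_d)$, $\vec x'$, and $n$ ranging over $\mathbb N$; $\vec y=(\vec x,n,\vec x')$. A loop $\langle\chi,\vec a\rangle$ consists of a quantifier-free formula $\chi$ over atoms $p>0$ ($p$ an arithmetic expression over $\vec x$, integer semantics) and a map $\vec a:\mathbb Z^d\to\mathbb Z^d$ given by expressions over $\vec x$; $\vec a^m$ is $m$-fold application. $\vec x\longrightarrow_{\langle\chi,\vec a\rangle}\vec x'$ iff $\chi(\vec x)\land\vec x'=\vec a(\vec x)$, and $\longrightarrow^m$ is its $m$-fold composition. A conditional acceleration technique is a partial function $\mathit{accel}$ from pairs (loop $\langle\chi,\vec a\rangle$, quantifier-free formula $\check\phi$ over $\vec x$) to formulas over $\vec y$. It is sound if for all arguments in its domain, all $\vec x,\vec x'\in\mathbb Z^d$ and all $n>0$, $\vec x\longrightarrow^n_{\langle\check\phi,\vec a\rangle}\vec x'\land\mathit{accel}(\langle\chi,\vec a\rangle,\check\phi)$ implies $\vec x\longrightarrow^n_{\langle\chi,\vec a\rangle}\vec x'$;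 it is exact if it is sound and additionally $\vec x\longrightarrow^n_{\langle\chi\land\check\phi,\vec a\rangle}\vec x'$ implies $\mathit{accel}(\langle\chi,\vec a\rangle,\check\phi)$. Validity means truth for all integer values of the free variables. -}

module Defs where

open import Data.Nat using (ℕ; zero; suc)
import Data.Nat as ℕ
open import Data.Integer using (ℤ; _+_; _*_; -_; _<_; 0ℤ)
open import Data.Fin using (Fin)
open import Data.Vec using (Vec; lookup; map)
open import Data.Product using (_×_; ∃)
open import Data.Sum using (_⊎_)
open import Data.Unit using (⊤)
open import Data.Empty using (⊥)
open import Relation.Nullary using (¬_)
open import Relation.Binary.PropositionalEquality using (_≡_)

data Expr (d : ℕ) : Set where
  var   : Fin d → Expr d
  const : ℤ → Expr d
  _⊕_   : Expr d → Expr d → Expr d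
  _⊗_   : Expr d → Expr d → Expr d
  ⊖_    : Expr d → Expr d

eval : ∀ {d} → Expr d → Vec ℤ d → ℤ
eval (var i)   x = lookup x i
eval (const c) x = c
eval (p ⊕ q)   x = eval p x + eval q x
eval (p ⊗ q)   x = eval p x * eval q x
eval (⊖ p)     x = - eval p x

data Formula (d : ℕ) : Set where
  atom  : Expr d → Formula d
  tt ff : Formula d
  _∧ᶠ_  : Formula d → Formula d → Formula d
  _∨ᶠ_  : Formula d → Formula d → Formula d
  ¬ᶠ_   : Formula d → Formula d

⟦_⟧ : ∀ {d} → Formula d → Vec ℤ d → Set
⟦ atom p ⟧  x = 0ℤ < eval p x
⟦ tt ⟧      x = ⊤
⟦ ff ⟧      x = ⊥
⟦ φ ∧ᶠ ψ ⟧  x = ⟦ φ ⟧ x × ⟦ ψ ⟧ x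
⟦ φ ∨ᶠ ψ ⟧  x = ⟦ φ ⟧ x ⊎ ⟦ ψ ⟧ x
⟦ ¬ᶠ φ ⟧    x = ¬ ⟦ φ ⟧ x

Update : ℕ → Set
Update d = Vec (Expr d) d

apply : ∀ {d} → Update d → Vec ℤ d → Vec ℤ d
apply a x = map (λ e → eval e x) a

applyⁿ : ∀ {d} → Update d → ℕ → Vec ℤ d → Vec ℤ d
applyⁿ a zero    x = x
applyⁿ a (suc m) x = apply a (applyⁿ a m x)

record Loop (d : ℕ) : Set where
  constructor ⟨_,_⟩
  field
    guard  : Formula d
    update : Update d
open Loop public

Step : ∀ {d} → Loop d → Vec ℤ d → Vec ℤ d → Set
Step L x x' = ⟦ guard L ⟧ x × x' ≡ apply (update L) x

Steps : ∀ {d} → Loop d → ℕ → Vec ℤ d → Vec ℤ d → Set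
Steps L zero    x x' = x ≡ x'
Steps L (suc m) x x' = ∃ λ z → Step L x z × Steps L m z x'

-- Formulas over y = (x, n, x'), represented semantically.
YFormula : ℕ → Set₁
YFormula d = Vec ℤ d → ℕ → Vec ℤ d → Set

-- A partial conditional acceleration technique: a domain predicate
-- together with the value on (all) arguments (only used on the domain).
record AccelTechnique (d : ℕ) : Set₁ where
  field
    Dom   : Loop d → Formula d → Set
    accel : Loop d → Formula d → YFormula d
open AccelTechnique public

Sound : ∀ {d} → AccelTechnique d → Set
Sound {d} T = ∀ (L : Loop d) (φ : Formula d) → Dom T L φ →
  ∀ (x x' : Vec ℤ d) (n : ℕ) → 0 ℕ.< n →
  Steps ⟨ φ , update L ⟩ n x x' → accel T L φ x n x' → Steps L n x x'

Exact : ∀ {d} → AccelTechnique d → Set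
Exact {d} T = Sound T ×
  (∀ (L : Loop d) (φ : Formula d) → Dom T L φ →
   ∀ (x x' : Vec ℤ d) (n : ℕ) → 0 ℕ.< n →
   Steps ⟨ guard L ∧ᶠ φ , update L ⟩ n x x' → accel T L φ x n x')

accelTheorem8 : (d : ℕ) → AccelTechnique d
accelTheorem8 d = record
  { Dom   = λ L φ → ∀ (x : Vec ℤ d) → ⟦ φ ⟧ x → ⟦ guard L ⟧ x → ⟦ guard L ⟧ (apply (update L) x)
  ; accel = λ L φ x n x' → x' ≡ applyⁿ (update L) n x × ⟦ guard L ⟧ x
  }

{-# OPTIONS --safe #-}
module Submission where

-- Every run of a loop with update a ends in aⁿ(x), which gives the exactness
-- direction together with the guard at the first state.  For soundness, χ is
-- an invariant of the runs of ⟨φ̌, a⟩ once it holds initially, so every state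
-- of such a run also satisfies the guard χ.

open import Defs
open import Data.Nat using (ℕ; _≤_; _<_; zero; suc)
open import Data.Product using (_,_; proj₁)
open import Data.Vec using (Vec)
open import Data.Integer using (ℤ)
open import Relation.Binary.PropositionalEquality using (_≡_; refl; sym; trans; cong)

applyⁿ-apply : ∀ {d} (a : Update d) m (x : Vec ℤ d) →
               applyⁿ a m (apply a x) ≡ applyⁿ a (suc m) x
applyⁿ-apply a zero    x = refl
applyⁿ-apply a (suc m) x = cong (apply a) (applyⁿ-apply a m x)

Steps⇒applyⁿ : ∀ {d} (L : Loop d) n {x x' : Vec ℤ d} →
               Steps L n x x' → x' ≡ applyⁿ (update L) n x
Steps⇒applyⁿ L zero    x≡x' = sym x≡x'
Steps⇒applyⁿ L (suc n) {x} (_ , (_ , refl) , s) =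
  trans (Steps⇒applyⁿ L n s) (applyⁿ-apply (update L) n x)

Steps⇒guard : ∀ {d} (L : Loop d) n {x x' : Vec ℤ d} →
              0 < n → Steps L n x x' → ⟦ guard L ⟧ x
Steps⇒guard L (suc n) _ (_ , (g , _) , _) = g

Steps-invariant : ∀ {d} (χ φ : Formula d) (a : Update d) →
                  (∀ x → ⟦ φ ⟧ x → ⟦ χ ⟧ x → ⟦ χ ⟧ (apply a x)) →
                  ∀ n {x x'} → ⟦ χ ⟧ x →
                  Steps ⟨ φ , a ⟩ n x x' → Steps ⟨ χ , a ⟩ n x x'
Steps-invariant χ φ a inv zero    χx x≡x' = x≡x'
Steps-invariant χ φ a inv (suc n) {x} χx (z , (φx , z≡ax) , s) =
  z , (χx , z≡ax) , Steps-invariant χ φ a inv n χz s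
  where
  χz : ⟦ χ ⟧ z
  χz rewrite z≡ax = inv x φx χx

theorem8 : (d : ℕ) → 1 ≤ d → Exact (accelTheorem8 d)
theorem8 d _ = sound , λ L φ _ x x' → exact L φ
  where
  sound : Sound (accelTheorem8 d)
  sound ⟨ χ , a ⟩ φ inv _ _ n _ s (_ , χx) = Steps-invariant χ φ a inv n χx s

  exact : ∀ (L : Loop d) φ {x x' : Vec ℤ d} n → 0 < n →
          Steps ⟨ guard L ∧ᶠ φ , update L ⟩ n x x' → accel (accelTheorem8 d) L φ x n x'
  exact ⟨ χ , a ⟩ φ n 0<n s =
    Steps⇒applyⁿ ⟨ χ ∧ᶠ φ , a ⟩ n s ,
    proj₁ (Steps⇒guard ⟨ χ ∧ᶠ φ , a ⟩ n 0<n s)
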